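{- Let $\hat{G}=(\hat{V},\hat{E})$ be a directed graph and $n=|\hat{V}|$. Each execution of $\mathrm{SeqSC2}(\hat{G})$ creates $O(n\log n)$ shortcuts.
   Context: Write $u\preceq v$ for directed reachability in the current graph; $\lg$ is the base-2 logarithm. The randomized recursive procedure $\mathrm{SeqSC2}(G)$, for $G=(V,E)$ a subgraph arising in the execution on input $\hat{G}$ (top-level call at recursion depth $0$): if the recursion depth is $\lg n$, return $\emptyset$. Otherwise set $S\gets\emptyset$ and, while $V\neq\emptyset$: select $x\in V$ uniformly at random; let $R^+=\{v:x\preceq v\}$ and $R^-=\{u:u\preceq x\}$ (in the current $G$); $S\gets S\cup\{(x,v):v\in R^+\}\cup\{(u,x):u\in R^-\}$; let $V_B=R^+\cap R^-$, $V_S=R^+\setminus V_B$, $V_P=R^-\setminus V_B$, $V_R=V\setminus(V_B\cup V_S\cup V_P)$; $S\gets S\cup\mathrm{SeqSC2}(G[V_S])\cup\mathrm{SeqSC2}(G[V_P])$ (recursive calls at depth one greater); $G\gets G[V_R]$. Finally return $S$. The created shortcuts are the arcs put into $S$. -}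

module Defs where

open import Level using (suc; zero)
open import Data.Nat as ℕ using (ℕ)
open import Data.Nat.Logarithm using (⌈log₂_⌉)
open import Data.Fin using (Fin)
open import Data.Fin.Subset using (Subset; _∈_; _∩_; _∪_; _─_; Empty)
open import Data.Product using (_×_)
open import Data.Sum using (_⊎_)
open import Data.Empty using (⊥)
open import Relation.Binary.PropositionalEquality using (_≡_; _≢_)
open import Function.Bundles using (_⇔_)

-- A directed graph Ĝ on vertex set Fin n, with arc relation E.
-- Reach E V x y : x ⪯ y in the induced subgraph Ĝ[V]
-- (a directed path from x to y all of whose vertices lie in V; reflexive on V).
data Reach {n : ℕ} (E : Fin n → Fin n → Set) (V : Subset n) : Fin n → Fin n → Set where
  here : ∀ {x} → x ∈ V → Reach E V x x
  step : ∀ {x y z} → x ∈ V → E x y → Reach E V y z → Reach E V x z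

Arcs : ℕ → Set₁
Arcs n = Fin n → Fin n → Set

∅ₐ : ∀ {n} → Arcs n
∅ₐ _ _ = ⊥

-- Executions of SeqSC2 on top-level input (Fin n, E); n = |V̂| is fixed
-- throughout the recursion.  The random choice of x is modelled by allowing
-- every x ∈ V, so these relations describe *every* possible execution.
--   Call E d V S : a call SeqSC2(Ĝ[V]) at recursion depth d can return S.
--   Loop E d V S : the while-loop of a call at depth d, started with current
--                  vertex set V, can produce the shortcut set S.
-- The depth cutoff "lg n" is read as ⌈log₂ n⌉.
mutual
  data Call {n : ℕ} (E : Fin n → Fin n → Set) (d : ℕ) (V : Subset n) : Arcs n → Set₁ where
    cutoff : d ≡ ⌈log₂ n ⌉ → Call E d V ∅ₐ
    run    : ∀ {S} → d ≢ ⌈log₂ n ⌉ → Loop E d V S → Call E d V S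

  data Loop {n : ℕ} (E : Fin n → Fin n → Set) (d : ℕ) (V : Subset n) : Arcs n → Set₁ where
    done : Empty V → Loop E d V ∅ₐ
    iter : ∀ {S₁ S₂ S₃} (x : Fin n) → x ∈ V →
           (R⁺ R⁻ : Subset n) →
           (∀ v → (v ∈ R⁺) ⇔ Reach E V x v) →
           (∀ u → (u ∈ R⁻) ⇔ Reach E V u x) →
           Call E (ℕ.suc d) (R⁺ ─ (R⁺ ∩ R⁻)) S₁ →
           Call E (ℕ.suc d) (R⁻ ─ (R⁺ ∩ R⁻)) S₂ →
           Loop E d (V ─ (R⁺ ∪ R⁻)) S₃ →
           Loop E d V (λ a b → ((a ≡ x) × (b ∈ R⁺)) ⊎ ((a ∈ R⁻) × (b ≡ x))
                              ⊎ S₁ a b ⊎ S₂ a b ⊎ S₃ a b)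

-- A call at depth d on a vertex set V creates at most 2|V|(⌈lg n⌉ − d)
-- shortcuts.  A pivot x of the while-loop adds |R⁺| + |R⁻| ≤ 2|R⁺ ∪ R⁻|
-- shortcuts and hands the disjoint sets V_S, V_P ⊆ R⁺ ∪ R⁻ to the next level,
-- while the loop continues on V ∖ (R⁺ ∪ R⁻); so every vertex pays 2 per level,
-- and there are ⌈lg n⌉ levels.  Since shortcut sets are predicates, they are
-- counted through an explicit list of arcs covering them.
module Submission where

open import Defs
open import Data.Nat using (ℕ; _≤_; _*_)
open import Data.Nat.Logarithm using (⌈log₂_⌉)
open import Data.Fin using (Fin)
open import Data.Fin.Subset using (⊤)
open import Data.Product using (_×_; _,_; ∃-syntax)
open import Data.List using (List; length)
open import Data.List.Membership.Propositional using (_∈_)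
open import Data.List.Relation.Unary.Unique.Propositional using (Unique)

open import Data.Nat using (zero; suc; _+_; z≤n; s≤s)
open import Data.Nat.Properties
  using (≤-trans; ≤-reflexive; +-mono-≤; +-monoˡ-≤; *-monoˡ-≤; *-monoʳ-≤; m≤n⇒m≤1+n;
         +-suc; +-identityʳ; module ≤-Reasoning)
open import Data.Nat.Tactic.RingSolver using (solve-∀)
open import Data.Fin as Fin using ()
open import Data.Fin.Subset
  using (Subset; inside; outside; ∣_∣; _∪_; _∩_; _─_)
  renaming (_∈_ to _∈ₛ_; _⊆_ to _⊆ₛ_)
open import Data.Fin.Subset.Properties
  using (∣p∣≤∣p∪q∣; ∣q∣≤∣p∪q∣; ∣⊤∣≡n; drop-∷-⊆; x∈p∪q⁻)
open import Data.Vec using ([]; _∷_; _[_]=_)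
open import Data.List using ([]; _∷_; map; _++_; removeAt)
open import Data.List.Properties using (length-map; length-++; length-removeAt′)
open import Data.List.Relation.Unary.Any using (here; there; index)
open import Data.List.Relation.Unary.All using (lookup)
open import Data.List.Relation.Unary.AllPairs using (_∷_)
open import Data.List.Membership.Propositional.Properties using (∈-map⁺; ∈-++⁺ˡ; ∈-++⁺ʳ)
open import Data.Sum using (_⊎_; [_,_]′)
open import Function using (_∘_)
open import Data.Empty using (⊥-elim)
open import Relation.Binary.PropositionalEquality
  using (_≡_; _≢_; refl; sym; trans; cong; subst)
open import Function.Bundles using (Equivalence)

module _ {A : Set} where

  ∈-removeAt : ∀ {x y : A} {ys : List A} (x∈ys : x ∈ ys) → y ∈ ys → x ≢ y →
               y ∈ removeAt ys (index x∈ys)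
  ∈-removeAt (here refl)  (here refl)  x≢y = ⊥-elim (x≢y refl)
  ∈-removeAt (here _)     (there y∈ys) _   = y∈ys
  ∈-removeAt (there _)    (here y≡z)   _   = here y≡z
  ∈-removeAt (there x∈ys) (there y∈ys) x≢y = there (∈-removeAt x∈ys y∈ys x≢y)

  Unique⇒length≤ : ∀ {xs ys : List A} → Unique xs → (∀ {z} → z ∈ xs → z ∈ ys) →
                   length xs ≤ length ys
  Unique⇒length≤ {[]}          _              _   = z≤n
  Unique⇒length≤ {x ∷ xs} {ys} (x≢xs ∷ xs-unique) inj = begin
    suc (length xs)                         ≤⟨ s≤s (Unique⇒length≤ xs-unique y∈ys─x) ⟩
    suc (length (removeAt ys (index x∈ys))) ≡⟨ sym (length-removeAt′ ys (index x∈ys)) ⟩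
    length ys                               ∎
    where
    open ≤-Reasoning
    x∈ys : x ∈ ys
    x∈ys = inj (here refl)
    y∈ys─x : ∀ {y} → y ∈ xs → y ∈ removeAt ys (index x∈ys)
    y∈ys─x y∈xs = ∈-removeAt x∈ys (inj (there y∈xs)) (lookup x≢xs y∈xs)

module _ {n : ℕ} where

  ∪-⊆ : {p q r : Subset n} → p ⊆ₛ r → q ⊆ₛ r → p ∪ q ⊆ₛ r
  ∪-⊆ {p} {q} p⊆r q⊆r i∈p∪q = [ p⊆r , q⊆r ]′ (x∈p∪q⁻ p q i∈p∪q)

  Reach-source∈ : ∀ {E : Fin n → Fin n → Set} {V x y} → Reach E V x y → x ∈ₛ V
  Reach-source∈ (here x∈V)     = x∈V
  Reach-source∈ (step x∈V _ _) = x∈V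

  Reach-target∈ : ∀ {E : Fin n → Fin n → Set} {V x y} → Reach E V x y → y ∈ₛ V
  Reach-target∈ (here y∈V)  = y∈V
  Reach-target∈ (step _ _ r) = Reach-target∈ r

∣p─p∩q∣+∣q─p∩q∣≤∣p∪q∣ : ∀ {n} (p q : Subset n) →
                          ∣ p ─ (p ∩ q) ∣ + ∣ q ─ (p ∩ q) ∣ ≤ ∣ p ∪ q ∣
∣p─p∩q∣+∣q─p∩q∣≤∣p∪q∣ []            []            = z≤n
∣p─p∩q∣+∣q─p∩q∣≤∣p∪q∣ (inside  ∷ p) (inside  ∷ q) = m≤n⇒m≤1+n (∣p─p∩q∣+∣q─p∩q∣≤∣p∪q∣ p q)
∣p─p∩q∣+∣q─p∩q∣≤∣p∪q∣ (inside  ∷ p) (outside ∷ q) = s≤s (∣p─p∩q∣+∣q─p∩q∣≤∣p∪q∣ p q)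
∣p─p∩q∣+∣q─p∩q∣≤∣p∪q∣ (outside ∷ p) (inside  ∷ q) =
  subst (_≤ suc ∣ p ∪ q ∣) (sym (+-suc ∣ p ─ (p ∩ q) ∣ _)) (s≤s (∣p─p∩q∣+∣q─p∩q∣≤∣p∪q∣ p q))
∣p─p∩q∣+∣q─p∩q∣≤∣p∪q∣ (outside ∷ p) (outside ∷ q) = ∣p─p∩q∣+∣q─p∩q∣≤∣p∪q∣ p q

p⊆q⇒∣p∣+∣q─p∣≡∣q∣ : ∀ {n} {p q : Subset n} → p ⊆ₛ q → ∣ p ∣ + ∣ q ─ p ∣ ≡ ∣ q ∣
p⊆q⇒∣p∣+∣q─p∣≡∣q∣ {p = []}          {[]}          _   = refl
p⊆q⇒∣p∣+∣q─p∣≡∣q∣ {p = inside  ∷ p} {inside  ∷ q} p⊆q = cong suc (p⊆q⇒∣p∣+∣q─p∣≡∣q∣ (drop-∷-⊆ p⊆q))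
p⊆q⇒∣p∣+∣q─p∣≡∣q∣ {p = inside  ∷ p} {outside ∷ q} p⊆q with p⊆q _[_]=_.here
... | ()
p⊆q⇒∣p∣+∣q─p∣≡∣q∣ {p = outside ∷ p} {inside  ∷ q} p⊆q =
  trans (+-suc ∣ p ∣ _) (cong suc (p⊆q⇒∣p∣+∣q─p∣≡∣q∣ (drop-∷-⊆ p⊆q)))
p⊆q⇒∣p∣+∣q─p∣≡∣q∣ {p = outside ∷ p} {outside ∷ q} p⊆q = p⊆q⇒∣p∣+∣q─p∣≡∣q∣ (drop-∷-⊆ p⊆q)

elements : ∀ {n} → Subset n → List (Fin n)
elements []            = []
elements (inside  ∷ p) = Fin.zero ∷ map Fin.suc (elements p)
elements (outside ∷ p) = map Fin.suc (elements p)

length-elements : ∀ {n} (p : Subset n) → length (elements p) ≡ ∣ p ∣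
length-elements []            = refl
length-elements (inside  ∷ p) = cong suc (trans (length-map Fin.suc (elements p)) (length-elements p))
length-elements (outside ∷ p) = trans (length-map Fin.suc (elements p)) (length-elements p)

∈ₛ⇒∈-elements : ∀ {n} {p : Subset n} {i} → i ∈ₛ p → i ∈ elements p
∈ₛ⇒∈-elements {p = inside  ∷ p} _[_]=_.here       = here refl
∈ₛ⇒∈-elements {p = inside  ∷ p} (_[_]=_.there i∈p) = there (∈-map⁺ Fin.suc (∈ₛ⇒∈-elements i∈p))
∈ₛ⇒∈-elements {p = outside ∷ p} (_[_]=_.there i∈p) = ∈-map⁺ Fin.suc (∈ₛ⇒∈-elements i∈p)

module _ {n : ℕ} where

  _∪ₐ_ : Arcs n → Arcs n → Arcs n
  (S ∪ₐ T) a b = S a b ⊎ T a b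

  arcsFrom : Fin n → Subset n → Arcs n
  arcsFrom x R a b = a ≡ x × b ∈ₛ R

  arcsTo : Fin n → Subset n → Arcs n
  arcsTo x R a b = a ∈ₛ R × b ≡ x

  record Cover (S : Arcs n) (m : ℕ) : Set where
    field
      arcs     : List (Fin n × Fin n)
      complete : ∀ {a b} → S a b → (a , b) ∈ arcs
      length≤  : length arcs ≤ m

  open Cover

  ∅-cover : ∀ {m} → Cover ∅ₐ m
  ∅-cover = record { arcs = [] ; complete = λ () ; length≤ = z≤n }

  cover-weaken : ∀ {S m m′} → m ≤ m′ → Cover S m → Cover S m′
  cover-weaken m≤m′ C = record
    { arcs = arcs C ; complete = complete C ; length≤ = ≤-trans (length≤ C) m≤m′ }

  cover-∪ : ∀ {S T m m′} → Cover S m → Cover T m′ → Cover (S ∪ₐ T) (m + m′)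
  cover-∪ C D = record
    { arcs     = arcs C ++ arcs D
    ; complete = [ ∈-++⁺ˡ ∘ complete C , ∈-++⁺ʳ (arcs C) ∘ complete D ]′
    ; length≤  = subst (_≤ _) (sym (length-++ (arcs C))) (+-mono-≤ (length≤ C) (length≤ D))
    }

  arcsFrom-cover : ∀ x R → Cover (arcsFrom x R) ∣ R ∣
  arcsFrom-cover x R = record
    { arcs     = map (x ,_) (elements R)
    ; complete = λ { (refl , b∈R) → ∈-map⁺ (x ,_) (∈ₛ⇒∈-elements b∈R) }
    ; length≤  = ≤-reflexive (trans (length-map (x ,_) (elements R)) (length-elements R))
    }

  arcsTo-cover : ∀ x R → Cover (arcsTo x R) ∣ R ∣
  arcsTo-cover x R = record
    { arcs     = map (_, x) (elements R)
    ; complete = λ { (a∈R , refl) → ∈-map⁺ (_, x) (∈ₛ⇒∈-elements a∈R) }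
    ; length≤  = ≤-reflexive (trans (length-map (_, x) (elements R)) (length-elements R))
    }

shortcut-budget : ∀ {a b s p u r ℓ} → a + b ≤ u + u → s + p ≤ u →
                  a + (b + (2 * (s * ℓ) + (2 * (p * ℓ) + 2 * (r * suc ℓ))))
                    ≤ 2 * ((u + r) * suc ℓ)
shortcut-budget {a} {b} {s} {p} {u} {r} {ℓ} a+b≤2u s+p≤u = begin
  a + (b + (2 * (s * ℓ) + (2 * (p * ℓ) + 2 * (r * suc ℓ))))
    ≡⟨ regroup a b s p r ℓ ⟩
  (a + b) + (2 * ((s + p) * ℓ) + 2 * (r * suc ℓ))
    ≤⟨ +-mono-≤ a+b≤2u (+-monoˡ-≤ (2 * (r * suc ℓ)) (*-monoʳ-≤ 2 (*-monoˡ-≤ ℓ s+p≤u))) ⟩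
  (u + u) + (2 * (u * ℓ) + 2 * (r * suc ℓ))
    ≡⟨ collect u r ℓ ⟩
  2 * ((u + r) * suc ℓ) ∎
  where
  open ≤-Reasoning
  regroup : ∀ a b s p r ℓ → a + (b + (2 * (s * ℓ) + (2 * (p * ℓ) + 2 * (r * suc ℓ))))
                          ≡ (a + b) + (2 * ((s + p) * ℓ) + 2 * (r * suc ℓ))
  regroup = solve-∀
  collect : ∀ u r ℓ → (u + u) + (2 * (u * ℓ) + 2 * (r * suc ℓ)) ≡ 2 * ((u + r) * suc ℓ)
  collect = solve-∀

module ShortcutCount {n : ℕ} (E : Fin n → Fin n → Set) where

  mutual
    call-cover : ∀ {d V S} ℓ → d + ℓ ≡ ⌈log₂ n ⌉ → Call E d V S → Cover S (2 * (∣ V ∣ * ℓ))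
    call-cover         _       _       (cutoff _)    = ∅-cover
    call-cover         zero    d+0≡lgn (run d≢lgn _) = ⊥-elim (d≢lgn (trans (sym (+-identityʳ _)) d+0≡lgn))
    call-cover {d = d} (suc ℓ) d+ℓ≡lgn (run _ loop)  = loop-cover ℓ (trans (sym (+-suc d ℓ)) d+ℓ≡lgn) loop

    loop-cover : ∀ {d V S} ℓ → suc d + ℓ ≡ ⌈log₂ n ⌉ → Loop E d V S → Cover S (2 * (∣ V ∣ * suc ℓ))
    loop-cover _ _ (done _) = ∅-cover
    loop-cover {V = V} ℓ eq (iter x _ R⁺ R⁻ R⁺-reach R⁻-reach succs preds rest) =
      cover-weaken budget
        (cover-∪ (arcsFrom-cover x R⁺) (cover-∪ (arcsTo-cover x R⁻)
          (cover-∪ (call-cover ℓ eq succs) (cover-∪ (call-cover ℓ eq preds) (loop-cover ℓ eq rest)))))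
      where
      open Equivalence
      R⁺∪R⁻⊆V : R⁺ ∪ R⁻ ⊆ₛ V
      R⁺∪R⁻⊆V = ∪-⊆ (λ {v} v∈R⁺ → Reach-target∈ (to (R⁺-reach v) v∈R⁺))
                    (λ {u} u∈R⁻ → Reach-source∈ (to (R⁻-reach u) u∈R⁻))
      budget : ∣ R⁺ ∣ + (∣ R⁻ ∣ + (2 * (∣ R⁺ ─ (R⁺ ∩ R⁻) ∣ * ℓ) + (2 * (∣ R⁻ ─ (R⁺ ∩ R⁻) ∣ * ℓ)
                 + 2 * (∣ V ─ (R⁺ ∪ R⁻) ∣ * suc ℓ))))
               ≤ 2 * (∣ V ∣ * suc ℓ)
      budget = begin
        _ ≤⟨ shortcut-budget {∣ R⁺ ∣} {∣ R⁻ ∣} {∣ R⁺ ─ (R⁺ ∩ R⁻) ∣} {∣ R⁻ ─ (R⁺ ∩ R⁻) ∣}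
                             (+-mono-≤ (∣p∣≤∣p∪q∣ R⁺ R⁻) (∣q∣≤∣p∪q∣ R⁺ R⁻))
                             (∣p─p∩q∣+∣q─p∩q∣≤∣p∪q∣ R⁺ R⁻) ⟩
        2 * ((∣ R⁺ ∪ R⁻ ∣ + ∣ V ─ (R⁺ ∪ R⁻) ∣) * suc ℓ)
          ≡⟨ cong (λ m → 2 * (m * suc ℓ)) (p⊆q⇒∣p∣+∣q─p∣≡∣q∣ R⁺∪R⁻⊆V) ⟩
        2 * (∣ V ∣ * suc ℓ) ∎
        where open ≤-Reasoning

lemma12 : ∃[ c ] ∃[ n₀ ] (∀ (n : ℕ) → n₀ ≤ n → (E : Fin n → Fin n → Set) → (S : Arcs n) →
    Call E 0 ⊤ S →
    (L : List (Fin n × Fin n)) → Unique L → (∀ a b → (a , b) ∈ L → S a b) →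
    length L ≤ c * (n * ⌈log₂ n ⌉))
lemma12 = 2 , 0 , λ n _ E _ call L L-unique L⊆S →
  let C = ShortcutCount.call-cover E ⌈log₂ n ⌉ refl call in
  ≤-trans (Unique⇒length≤ L-unique (λ { {a , b} ab∈L → Cover.complete C (L⊆S a b ab∈L) }))
          (subst (λ m → length (Cover.arcs C) ≤ 2 * (m * ⌈log₂ n ⌉)) (∣⊤∣≡n n) (Cover.length≤ C))
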